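{- For any set of $c$ partitions $\{\mathcal{P}_1,\dots,\mathcal{P}_c\}$ of the set $[n]$, there exists a partition of $[n]$ into $m$ base sets $B_1,\dots,B_m$ with $m<2^{c-1}\cdot n^{1-(1/2^{c-1})}$ such that for every $i\in[m]$ there exists an ordering $(\mathcal{P}_{i_1},\dots,\mathcal{P}_{i_c})$ of the partitions with $d_{B_i}(\mathcal{P}_{i_1},\mathcal{P}_{i_2},\dots,\mathcal{P}_{i_c})=1$.
   Context: Parts of a partition are called colors. For a partition $\mathcal{P}$ of $[n]$ and $B\subseteq[n]$, $\mathcal{P}|_B$ is the partition of $B$ whose colors are the nonempty sets $Y\cap B$, $Y\in\mathcal{P}$. The distance $d(\mathcal{Q}_1,\dots,\mathcal{Q}_c)$ of a sequence of partitions of a set is the least $\Delta$ such that for every $i\in\{2,\dots,c\}$ and every color $Y_1\in\mathcal{Q}_i$ there exist colors $Y_2,\dots,Y_{\Delta'}\in\mathcal{Q}_i$, $\Delta'\le\Delta$, with $Y_1\cup\dots\cup Y_{\Delta'}$ equal to a union of some colors of $\mathcal{Q}_j$ for every $j\in[i-1]$. For $B\subseteq[n]$, $d_B(\mathcal{Q}_1,\dots,\mathcal{Q}_c):=d(\mathcal{Q}_1|_B,\dots,\mathcal{Q}_c|_B)$. -}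

module Defs where

open import Data.Nat using (ℕ; suc; _≤_; _<_)
open import Data.Fin using (Fin; toℕ)
open import Data.List using (List; length)
open import Data.List.Membership.Propositional using (_∈_)
open import Data.List.Relation.Unary.All using (All)
open import Data.Product using (Σ; ∃; _×_)
open import Data.Sum using (_⊎_)
open import Relation.Binary.PropositionalEquality using (_≡_)

-- A partition of [n] is given by a colour labelling Fin n → ℕ:
-- its colours are the nonempty fibres {x | P x ≡ ℓ}.
Partition : ℕ → Set
Partition n = Fin n → ℕ

SubsetP : ℕ → Set₁
SubsetP n = Fin n → Set

IsColorOf : ∀ {n} → Partition n → SubsetP n → ℕ → Set
IsColorOf P B ℓ = ∃ λ x → B x × P x ≡ ℓ

IsUnionOfColors : ∀ {n} → Partition n → SubsetP n → SubsetP n → Set₁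
IsUnionOfColors P B Y =
  Σ (ℕ → Set) λ L → ∀ x → ((Y x → B x × L (P x)) × (B x × L (P x) → Y x))

-- The condition in the definition of d_B(Q_1,…,Q_c) for a given Δ
-- (indices are 0-based: "i ∈ {2..c}" is toℕ i ≥ 1, "j ∈ [i-1]" is toℕ j < toℕ i).
-- The colours Y_1 (label ℓ₁) and Y_2..Y_Δ' (labels ys) of Q_i|_B, Δ' = 1 + length ys.
DistCond : ∀ {n c} → SubsetP n → (Fin c → Partition n) → ℕ → Set₁
DistCond {n} {c} B Q Δ =
  ∀ (i : Fin c) → 1 ≤ toℕ i →
  ∀ (ℓ₁ : ℕ) → IsColorOf (Q i) B ℓ₁ →
  Σ (List ℕ) λ ys →
    (suc (length ys) ≤ Δ) ×
    All (IsColorOf (Q i) B) ys ×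
    (∀ (j : Fin c) → toℕ j < toℕ i →
       IsUnionOfColors (Q j) B (λ x → B x × (Q i x ≡ ℓ₁ ⊎ Q i x ∈ ys)))

DistanceIs : ∀ {n c} → SubsetP n → (Fin c → Partition n) → ℕ → Set₁
DistanceIs B Q Δ = DistCond B Q Δ × (∀ Δ' → DistCond B Q Δ' → Δ ≤ Δ')

module Submission where

-- The base sets are the fibres of a labelling of [n] built by treating P₂, …, P_c in turn.
-- Given a labelling with T labels and the next partition Q, let s be least with n ≤ s² T and
-- split every fibre into Q-colour classes. A class with at least s points keeps its colour as
-- new tag, so Q is constant on the new fibre; the points of a smaller class are tagged by their
-- rank in it, so Q is injective on the new fibres. There are at most n / s large classes and at
-- most (s - 1) T new small labels, whence the new count T' satisfies T'² < 4 n T, and by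
-- induction the final count m satisfies m ^ 2^(c-1) < (4 n) ^ (2^(c-1) - 1). On a base set each
-- P_j (j ≥ 2) is constant or injective, so listing the injective ones, then P₁, then the
-- constant ones makes every partition refine all later ones: distance 1.

open import Defs
open import Data.Nat using (ℕ; zero; suc; _≤_; _<_; _^_; _*_; _∸_; _+_; z≤n; s≤s; _≟_; _≤?_; _<?_)
open import Data.Nat.Properties
open import Data.Nat.ListAction using (sum)
open import Data.Nat.Tactic.RingSolver using (solve-∀)
open import Data.Fin using (Fin; toℕ; zero; suc)
open import Data.Fin.Properties using (toℕ-injective; toℕ<n; injective⇒≤)
open import Data.Fin.Permutation using (Permutation′; _⟨$⟩ʳ_; transpose; lift₀; _∘ₚ_)
import Data.Fin.Permutation as Permutation
open import Data.Product using (Σ; ∃; _×_; _,_; proj₁; proj₂)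
open import Data.Sum using (_⊎_; inj₁; inj₂)
import Data.Sum.Properties as Sum
open import Data.Vec using (Vec; []; _∷_; lookup; tabulate)
import Data.Vec.Properties as Vec
open import Data.List as List using (List; []; _∷_; length; map; _++_; allFin; upTo; filter; deduplicate; cartesianProductWith)
open import Data.List.Properties using (length-map; length-++; length-upTo; length-tabulate)
open import Data.List.Relation.Unary.Any using (here; there; index)
open import Data.List.Relation.Unary.Any.Properties using (lookup-index)
open import Data.List.Relation.Unary.All as All using (All; []; _∷_)
open import Data.List.Relation.Unary.AllPairs using ([]; _∷_)
open import Data.List.Relation.Unary.Unique.Propositional using (Unique)
open import Data.List.Relation.Unary.Unique.DecPropositional.Properties using (deduplicate-!)
open import Data.List.Relation.Binary.Subset.Propositional using (_⊆_)
open import Data.List.Membership.Propositional using (_∈_)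
open import Data.List.Membership.Propositional.Properties
  using (∈-lookup; ∈-map⁺; ∈-map⁻; ∈-++⁺ˡ; ∈-++⁺ʳ; ∈-upTo⁺; ∈-filter⁺; ∈-filter⁻; ∈-allFin;
         ∈-deduplicate⁺; ∈-deduplicate⁻; ∈-cartesianProductWith⁺)
open import Algebra.Properties.CommutativeSemigroup +-commutativeSemigroup using () renaming (interchange to +-interchange)
open import Algebra.Properties.CommutativeSemigroup *-commutativeSemigroup using () renaming (interchange to *-interchange)
open import Relation.Nullary using (Dec; yes; no; ¬_)
open import Relation.Nullary.Decidable using (_×-dec_)
open import Relation.Unary using (Decidable)
open import Relation.Binary.Definitions using (DecidableEquality; tri<; tri≈; tri>)
open import Relation.Binary.PropositionalEquality
open import Data.Empty using (⊥-elim)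
open import Function using (_∘_)

module _ {a} {A : Set a} where

  lookup-injective : ∀ {xs : List A} → Unique xs → ∀ i j → List.lookup xs i ≡ List.lookup xs j → i ≡ j
  lookup-injective {_ ∷ _} _          zero    zero    _  = refl
  lookup-injective {_ ∷ _} (x∉xs ∷ _) zero    (suc j) eq = ⊥-elim (All.lookup x∉xs (∈-lookup j) eq)
  lookup-injective {_ ∷ _} (x∉xs ∷ _) (suc i) zero    eq = ⊥-elim (All.lookup x∉xs (∈-lookup i) (sym eq))
  lookup-injective {_ ∷ _} (_ ∷ u)    (suc i) (suc j) eq = cong suc (lookup-injective u i j eq)

  Unique-⊆⇒length≤ : ∀ {xs ys : List A} → Unique xs → xs ⊆ ys → length xs ≤ length ys
  Unique-⊆⇒length≤ {xs} {ys} u xs⊆ys = injective⇒≤ embed-injective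
    where
    embed : Fin (length xs) → Fin (length ys)
    embed i = index (xs⊆ys (∈-lookup i))

    embed-injective : ∀ {i j} → embed i ≡ embed j → i ≡ j
    embed-injective {i} {j} eq = lookup-injective u i j (begin
      List.lookup xs i          ≡⟨ lookup-index (xs⊆ys (∈-lookup i)) ⟩
      List.lookup ys (embed i)  ≡⟨ cong (List.lookup ys) eq ⟩
      List.lookup ys (embed j)  ≡⟨ lookup-index (xs⊆ys (∈-lookup j)) ⟨
      List.lookup xs j          ∎)
      where open ≡-Reasoning

  sum-map-+ : ∀ (g h : A → ℕ) xs → sum (map (λ x → g x + h x) xs) ≡ sum (map g xs) + sum (map h xs)
  sum-map-+ g h []       = refl
  sum-map-+ g h (x ∷ xs) =
    trans (cong (g x + h x +_) (sum-map-+ g h xs)) (+-interchange (g x) (h x) _ _)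

  length*≤sum : ∀ {s} (g : A → ℕ) xs → (∀ {x} → x ∈ xs → s ≤ g x) → length xs * s ≤ sum (map g xs)
  length*≤sum g []       _      = z≤n
  length*≤sum g (x ∷ xs) s≤g[_] = +-mono-≤ s≤g[ here refl ] (length*≤sum g xs (λ x∈xs → s≤g[ there x∈xs ]))

length-cartesianProductWith : ∀ {a b c} {A : Set a} {B : Set b} {C : Set c} (f : A → B → C) xs ys →
  length (cartesianProductWith f xs ys) ≡ length xs * length ys
length-cartesianProductWith f []       ys = refl
length-cartesianProductWith f (x ∷ xs) ys = begin
  length (map (f x) ys ++ cartesianProductWith f xs ys)
    ≡⟨ length-++ (map (f x) ys) ⟩
  length (map (f x) ys) + length (cartesianProductWith f xs ys)
    ≡⟨ cong₂ _+_ (length-map (f x) ys) (length-cartesianProductWith f xs ys) ⟩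
  length ys + length xs * length ys
    ∎
  where open ≡-Reasoning

indicator : ∀ {p} {P : Set p} → Dec P → ℕ
indicator (yes _) = 1
indicator (no _)  = 0

module _ {a} {A : Set a} where

  count : ∀ {p} {P : A → Set p} → Decidable P → List A → ℕ
  count P? []       = 0
  count P? (x ∷ xs) = indicator (P? x) + count P? xs

  module _ {p q} {P : A → Set p} {Q : A → Set q} (P? : Decidable P) (Q? : Decidable Q) (P⇒Q : ∀ {x} → P x → Q x) where

    indicator-mono : ∀ x → indicator (P? x) ≤ indicator (Q? x)
    indicator-mono x with P? x | Q? x
    ... | yes _  | yes _  = ≤-refl
    ... | yes px | no ¬qx = ⊥-elim (¬qx (P⇒Q px))
    ... | no _   | _      = z≤n

    count-mono : ∀ xs → count P? xs ≤ count Q? xs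
    count-mono []       = z≤n
    count-mono (x ∷ xs) = +-mono-≤ (indicator-mono x) (count-mono xs)

    count-mono-< : ∀ {z} xs → z ∈ xs → Q z → ¬ P z → count P? xs < count Q? xs
    count-mono-< (x ∷ xs) (here refl) qx ¬px with P? x | Q? x
    ... | yes px | _      = ⊥-elim (¬px px)
    ... | no _   | no ¬qx = ⊥-elim (¬qx qx)
    ... | no _   | yes _  = s≤s (count-mono xs)
    count-mono-< (x ∷ xs) (there z∈xs) qz ¬pz =
      +-mono-≤-< (indicator-mono x) (count-mono-< xs z∈xs qz ¬pz)

module _ {a} {A : Set a} (_≟ᴬ_ : DecidableEquality A) where

  private
    sum-indicator-∉ : ∀ {w vs} → All (λ v → ¬ w ≡ v) vs → sum (map (λ v → indicator (w ≟ᴬ v)) vs) ≡ 0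
    sum-indicator-∉ []                      = refl
    sum-indicator-∉ {w} {v ∷ _} (w≢v ∷ w∉vs) with w ≟ᴬ v
    ... | yes w≡v = ⊥-elim (w≢v w≡v)
    ... | no _    = sum-indicator-∉ w∉vs

    sum-indicator≤1 : ∀ w {vs} → Unique vs → sum (map (λ v → indicator (w ≟ᴬ v)) vs) ≤ 1
    sum-indicator≤1 w {[]}     []            = z≤n
    sum-indicator≤1 w {v ∷ vs} (v∉vs ∷ u) with w ≟ᴬ v
    ... | yes refl = ≤-reflexive (cong suc (sum-indicator-∉ v∉vs))
    ... | no _     = sum-indicator≤1 w u

    sum-zeros : ∀ (vs : List A) → sum (map (λ _ → 0) vs) ≡ 0
    sum-zeros []       = refl
    sum-zeros (_ ∷ vs) = sum-zeros vs

  sum-count-fibres≤length : ∀ {b} {X : Set b} (f : X → A) {vs} → Unique vs → ∀ xs →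
    sum (map (λ v → count (λ x → f x ≟ᴬ v) xs) vs) ≤ length xs
  sum-count-fibres≤length f {vs} u []       = ≤-reflexive (sum-zeros vs)
  sum-count-fibres≤length f {vs} u (x ∷ xs) = begin
    sum (map (λ v → indicator (f x ≟ᴬ v) + count (λ y → f y ≟ᴬ v) xs) vs)
      ≡⟨ sum-map-+ (λ v → indicator (f x ≟ᴬ v)) (λ v → count (λ y → f y ≟ᴬ v) xs) vs ⟩
    sum (map (λ v → indicator (f x ≟ᴬ v)) vs) + sum (map (λ v → count (λ y → f y ≟ᴬ v) xs) vs)
      ≤⟨ +-mono-≤ (sum-indicator≤1 (f x) u) (sum-count-fibres≤length f u xs) ⟩
    suc (length xs) ∎
    where open ≤-Reasoning

  module _ {n} (f : Fin n → A) where

    image : List A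
    image = deduplicate _≟ᴬ_ (map f (allFin n))

    image-unique : Unique image
    image-unique = deduplicate-! _≟ᴬ_ (map f (allFin n))

    ∈-image : ∀ x → f x ∈ image
    ∈-image x = ∈-deduplicate⁺ _≟ᴬ_ (∈-map⁺ f (∈-allFin x))

    ∈-image⁻ : ∀ {v} → v ∈ image → ∃ λ x → v ≡ f x
    ∈-image⁻ v∈image with ∈-map⁻ f (∈-deduplicate⁻ _≟ᴬ_ (map f (allFin n)) v∈image)
    ... | x , _ , v≡fx = x , v≡fx

    imageIndex : Fin n → Fin (length image)
    imageIndex x = index (∈-image x)

    imageIndex-fibre : ∀ {x i} → imageIndex x ≡ i → f x ≡ List.lookup image i
    imageIndex-fibre {x} refl = lookup-index (∈-image x)

    imageIndex-surjective : ∀ i → ∃ λ x → imageIndex x ≡ i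
    imageIndex-surjective i with ∈-image⁻ (∈-lookup i)
    ... | x , lookup≡fx = x , lookup-injective image-unique (imageIndex x) i
                                 (trans (sym (imageIndex-fibre refl)) (sym lookup≡fx))

Tag : Set
Tag = ℕ ⊎ ℕ

_≟ᵗ_ : ∀ {k} → DecidableEquality (Vec Tag k)
_≟ᵗ_ = Vec.≡-dec (Sum.≡-dec _≟_ _≟_)

labels : ∀ {n k} → (Fin n → Vec Tag k) → List (Vec Tag k)
labels = image _≟ᵗ_

#labels : ∀ {n k} → (Fin n → Vec Tag k) → ℕ
#labels f = length (labels f)

-- A tag inj₁ ℓ records the colour of x under Q, a tag inj₂ r the rank of x within its colour class.
TagSound : ∀ {n} → Partition n → Tag → Fin n → Fin n → Set
TagSound Q (inj₁ _) x y = Q x ≡ Q y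
TagSound Q (inj₂ _) x y = Q x ≡ Q y → x ≡ y

module Refine {n k} (lab : Fin n → Vec Tag k) (Q : Partition n) (s : ℕ) where

  SameClass : Fin n → Fin n → Set
  SameClass x y = lab x ≡ lab y × Q x ≡ Q y

  sameClass? : ∀ x → Decidable (SameClass x)
  sameClass? x y = (lab x ≟ᵗ lab y) ×-dec (Q x ≟ Q y)

  SameClass-trans : ∀ {x y z} → SameClass x y → SameClass y z → SameClass x z
  SameClass-trans (lx≡ly , qx≡qy) (ly≡lz , qy≡qz) = trans lx≡ly ly≡lz , trans qx≡qy qy≡qz

  SameClass-sym : ∀ {x y} → SameClass x y → SameClass y x
  SameClass-sym (lx≡ly , qx≡qy) = sym lx≡ly , sym qx≡qy

  classSize : Fin n → ℕ
  classSize x = count (sameClass? x) (allFin n)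

  rank : Fin n → ℕ
  rank x = count (λ y → (toℕ y <? toℕ x) ×-dec sameClass? x y) (allFin n)

  classSize-cong : ∀ {x y} → SameClass x y → classSize x ≡ classSize y
  classSize-cong {x} {y} x~y = ≤-antisym
    (count-mono (sameClass? x) (sameClass? y) (SameClass-trans (SameClass-sym x~y)) (allFin n))
    (count-mono (sameClass? y) (sameClass? x) (SameClass-trans x~y) (allFin n))

  rank<classSize : ∀ x → rank x < classSize x
  rank<classSize x = count-mono-< _ (sameClass? x) proj₂ (allFin n) (∈-allFin x) (refl , refl)
    (λ (x<x , _) → <-irrefl refl x<x)

  rank-mono : ∀ {x y} → SameClass x y → toℕ x < toℕ y → rank x < rank y
  rank-mono {x} {y} x~y x<y = count-mono-< _ _
    (λ (z<x , x~z) → <-trans z<x x<y , SameClass-trans (SameClass-sym x~y) x~z)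
    (allFin n) (∈-allFin x) (x<y , SameClass-sym x~y) (λ (x<x , _) → <-irrefl refl x<x)

  rank-injective : ∀ {x y} → SameClass x y → rank x ≡ rank y → x ≡ y
  rank-injective {x} {y} x~y rx≡ry with <-cmp (toℕ x) (toℕ y)
  ... | tri< x<y _ _ = ⊥-elim (<-irrefl rx≡ry (rank-mono x~y x<y))
  ... | tri≈ _ x≡y _ = toℕ-injective x≡y
  ... | tri> _ _ y<x = ⊥-elim (<-irrefl (sym rx≡ry) (rank-mono (SameClass-sym x~y) y<x))

  Large : Fin n → Set
  Large x = s ≤ classSize x

  large? : Decidable Large
  large? x = s ≤? classSize x

  tag : Fin n → Tag
  tag x with large? x
  ... | yes _ = inj₁ (Q x)
  ... | no _  = inj₂ (rank x)

  refined : Fin n → Vec Tag (suc k)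
  refined x = tag x ∷ lab x

  tag-large : ∀ {x} → Large x → tag x ≡ inj₁ (Q x)
  tag-large {x} large with large? x
  ... | yes _     = refl
  ... | no ¬large = ⊥-elim (¬large large)

  tag-small : ∀ {x} → ¬ Large x → tag x ≡ inj₂ (rank x)
  tag-small {x} ¬large with large? x
  ... | yes large = ⊥-elim (¬large large)
  ... | no _      = refl

  refined-sound : ∀ {x y} → refined x ≡ refined y → TagSound Q (tag x) x y
  refined-sound {x} {y} eq with Vec.∷-injective eq
  ... | tx≡ty , lx≡ly with large? x | large? y
  ... | yes _ | yes _ = Sum.inj₁-injective tx≡ty
  ... | yes _ | no _  with () ← tx≡ty
  ... | no _  | yes _ with () ← tx≡ty
  ... | no _  | no _  = λ qx≡qy → rank-injective (lx≡ly , qx≡qy) (Sum.inj₂-injective tx≡ty)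

  refined-large : ∀ {x y} → Large x → SameClass x y → refined y ≡ refined x
  refined-large {x} {y} large x~y@(lx≡ly , qx≡qy) = cong₂ _∷_
    (begin
      tag y     ≡⟨ tag-large (subst (s ≤_) (classSize-cong x~y) large) ⟩
      inj₁ (Q y) ≡⟨ cong inj₁ qx≡qy ⟨
      inj₁ (Q x) ≡⟨ tag-large large ⟨
      tag x     ∎)
    (sym lx≡ly)
    where open ≡-Reasoning

  largeLabels : List (Vec Tag (suc k))
  largeLabels = deduplicate _≟ᵗ_ (map refined (filter large? (allFin n)))

  smallLabels : List (Vec Tag (suc k))
  smallLabels = cartesianProductWith (λ r l → inj₂ r ∷ l) (upTo (s ∸ 1)) (labels lab)

  labels-refined⊆ : labels refined ⊆ largeLabels ++ smallLabels
  labels-refined⊆ v∈labels with ∈-image⁻ _≟ᵗ_ refined v∈labels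
  ... | x , refl = by-size (large? x)
    where
    by-size : Dec (Large x) → refined x ∈ largeLabels ++ smallLabels
    by-size (yes large) =
      ∈-++⁺ˡ (∈-deduplicate⁺ _≟ᵗ_ (∈-map⁺ refined (∈-filter⁺ large? (∈-allFin x) large)))
    by-size (no ¬large) = ∈-++⁺ʳ largeLabels (subst (_∈ smallLabels) (cong (_∷ lab x) (sym (tag-small ¬large)))
      (∈-cartesianProductWith⁺ (λ r l → inj₂ r ∷ l) (∈-upTo⁺ rank<s∸1) (∈-image _≟ᵗ_ lab x)))
      where
      rank<s∸1 : rank x < s ∸ 1
      rank<s∸1 = ∸-monoˡ-≤ 1 (≤-trans (s≤s (rank<classSize x)) (≰⇒> ¬large))

  #labels-refined≤ : #labels refined ≤ length largeLabels + (s ∸ 1) * #labels lab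
  #labels-refined≤ = begin
    #labels refined
      ≤⟨ Unique-⊆⇒length≤ (image-unique _≟ᵗ_ refined) labels-refined⊆ ⟩
    length (largeLabels ++ smallLabels)
      ≡⟨ length-++ largeLabels ⟩
    length largeLabels + length smallLabels
      ≡⟨ cong (length largeLabels +_) (length-cartesianProductWith _ (upTo (s ∸ 1)) (labels lab)) ⟩
    length largeLabels + length (upTo (s ∸ 1)) * #labels lab
      ≡⟨ cong (λ r → length largeLabels + r * #labels lab) (length-upTo (s ∸ 1)) ⟩
    length largeLabels + (s ∸ 1) * #labels lab
      ∎
    where open ≤-Reasoning

  length-largeLabels*s≤n : length largeLabels * s ≤ n
  length-largeLabels*s≤n = begin
    length largeLabels * s                          ≤⟨ length*≤sum fibreSize largeLabels large-fibre ⟩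
    sum (map fibreSize largeLabels)                 ≤⟨ sum-count-fibres≤length _≟ᵗ_ refined largeLabels-unique (allFin n) ⟩
    length (allFin n)                               ≡⟨ length-tabulate (λ x → x) ⟩
    n                                               ∎
    where
    open ≤-Reasoning
    largeLabels-unique : Unique largeLabels
    largeLabels-unique = deduplicate-! _≟ᵗ_ (map refined (filter large? (allFin n)))

    fibreSize : Vec Tag (suc k) → ℕ
    fibreSize v = count (λ y → refined y ≟ᵗ v) (allFin n)

    large-fibre : ∀ {v} → v ∈ largeLabels → s ≤ fibreSize v
    large-fibre v∈large with ∈-map⁻ refined (∈-deduplicate⁻ _≟ᵗ_ _ v∈large)
    ... | x , x∈large , refl = ≤-trans large
          (count-mono (sameClass? x) (λ y → refined y ≟ᵗ refined x) (refined-large large) (allFin n))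
      where
      large : Large x
      large = proj₂ (∈-filter⁻ large? {xs = allFin n} x∈large)

least-s[n≤s*s*T] : ∀ n T → 1 ≤ n → 1 ≤ T → Σ ℕ λ s → n ≤ s * s * T × (s ∸ 1) * (s ∸ 1) * T < n
least-s[n≤s*s*T] n@(suc _) T@(suc _) 1≤n _ = descend n (≤-trans (m≤m*n n n) (m≤m*n (n * n) T))
  where
  descend : ∀ j → n ≤ j * j * T → Σ ℕ λ s → n ≤ s * s * T × (s ∸ 1) * (s ∸ 1) * T < n
  descend zero    n≤0 = ⊥-elim (<⇒≱ 1≤n n≤0)
  descend (suc j) n≤[j+1]²T with n ≤? j * j * T
  ... | yes n≤j²T = descend j n≤j²T
  ... | no  n≰j²T = suc j , n≤[j+1]²T , ≰⇒> n≰j²T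

double-square : ∀ x → (x + x) * (x + x) ≡ 4 * (x * x)
double-square = solve-∀

square-of-sum< : ∀ {a b N} → a * a ≤ N → b * b < N → (a + b) * (a + b) < 4 * N
square-of-sum< {a} {b} {N} a²≤N b²<N with a ≤? b
... | yes a≤b = begin-strict
  (a + b) * (a + b)  ≤⟨ *-mono-≤ (+-monoˡ-≤ b a≤b) (+-monoˡ-≤ b a≤b) ⟩
  (b + b) * (b + b)  ≡⟨ double-square b ⟩
  4 * (b * b)        <⟨ *-monoʳ-< 4 b²<N ⟩
  4 * N              ∎
  where open ≤-Reasoning
... | no a≰b = begin-strict
  (a + b) * (a + b)  <⟨ *-mono-< (+-monoʳ-< a (≰⇒> a≰b)) (+-monoʳ-< a (≰⇒> a≰b)) ⟩
  (a + a) * (a + a)  ≡⟨ double-square a ⟩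
  4 * (a * a)        ≤⟨ *-monoʳ-≤ 4 a²≤N ⟩
  4 * N              ∎
  where open ≤-Reasoning

-- With s the least integer such that n ≤ s² T, both summands of T' ≤ B + (s - 1) T are at most √(n T).
refinement-square-bound : ∀ {n T s B T'} → 1 ≤ T → n ≤ s * s * T → (s ∸ 1) * (s ∸ 1) * T < n →
  B * s ≤ n → T' ≤ B + (s ∸ 1) * T → T' * T' < 4 * n * T
refinement-square-bound {s = zero} _ n≤0 0<n _ _ = ⊥-elim (<⇒≱ 0<n n≤0)
refinement-square-bound {n} {T@(suc _)} {s@(suc s′)} {B} {T'} _ n≤s²T s′²T<n Bs≤n T'≤ = begin-strict
  T' * T'                      ≤⟨ *-mono-≤ T'≤ T'≤ ⟩
  (B + s′ * T) * (B + s′ * T)  <⟨ square-of-sum< {B} {s′ * T} B²≤nT [s′T]²<nT ⟩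
  4 * (n * T)                  ≡⟨ *-assoc 4 n T ⟨
  4 * n * T                    ∎
  where
  open ≤-Reasoning
  square-of-product : ∀ x y → x * y * (x * y) ≡ x * x * (y * y)
  square-of-product = solve-∀
  B²≤nT : B * B ≤ n * T
  B²≤nT = *-cancelʳ-≤ (B * B) (n * T) (s * s) (begin
    B * B * (s * s)    ≡⟨ square-of-product B s ⟨
    B * s * (B * s)    ≤⟨ *-mono-≤ Bs≤n Bs≤n ⟩
    n * n              ≤⟨ *-monoʳ-≤ n n≤s²T ⟩
    n * (s * s * T)    ≡⟨ cong (n *_) (*-comm (s * s) T) ⟩
    n * (T * (s * s))  ≡⟨ *-assoc n T (s * s) ⟨
    n * T * (s * s)    ∎)
  [s′T]²<nT : s′ * T * (s′ * T) < n * T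
  [s′T]²<nT = begin-strict
    s′ * T * (s′ * T)  ≡⟨ square-of-product s′ T ⟩
    s′ * s′ * (T * T)  ≡⟨ *-assoc (s′ * s′) T T ⟨
    s′ * s′ * T * T    <⟨ *-monoˡ-< T s′²T<n ⟩
    n * T              ∎

^-distribʳ-* : ∀ a b k → (a * b) ^ k ≡ a ^ k * b ^ k
^-distribʳ-* a b zero    = refl
^-distribʳ-* a b (suc k) = begin
  a * b * (a * b) ^ k      ≡⟨ cong (a * b *_) (^-distribʳ-* a b k) ⟩
  a * b * (a ^ k * b ^ k)  ≡⟨ *-interchange a b (a ^ k) (b ^ k) ⟩
  a * a ^ k * (b * b ^ k)  ∎
  where open ≡-Reasoning

power-step : ∀ {N T T'} K → 1 ≤ K → T ^ K ≤ N ^ (K ∸ 1) → T' * T' < N * T → T' ^ (2 * K) < N ^ (2 * K ∸ 1)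
power-step {N} {T} {T'} K@(suc _) 1≤K T^K≤ T'²<NT = begin-strict
  T' ^ (2 * K)         ≡⟨ cong (T' ^_) 2K≡K+K ⟩
  T' ^ (K + K)         ≡⟨ ^-distribˡ-+-* T' K K ⟩
  T' ^ K * T' ^ K      ≡⟨ ^-distribʳ-* T' T' K ⟨
  (T' * T') ^ K        <⟨ ^-monoˡ-< K T'²<NT ⟩
  (N * T) ^ K          ≡⟨ ^-distribʳ-* N T K ⟩
  N ^ K * T ^ K        ≤⟨ *-monoʳ-≤ (N ^ K) T^K≤ ⟩
  N ^ K * N ^ (K ∸ 1)  ≡⟨ ^-distribˡ-+-* N K (K ∸ 1) ⟨
  N ^ (K + (K ∸ 1))    ≡⟨ cong (N ^_) (+-∸-assoc K 1≤K) ⟨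
  N ^ (K + K ∸ 1)      ≡⟨ cong (λ e → N ^ (e ∸ 1)) 2K≡K+K ⟨
  N ^ (2 * K ∸ 1)      ∎
  where
  open ≤-Reasoning
  2K≡K+K : 2 * K ≡ K + K
  2K≡K+K = cong (K +_) (+-identityʳ K)

4^[2^k∸1]≤[2^k]^[2^k] : ∀ k → 1 ≤ k → 4 ^ (2 ^ k ∸ 1) ≤ (2 ^ k) ^ (2 ^ k)
4^[2^k∸1]≤[2^k]^[2^k] (suc zero)    _ = ≤-refl
4^[2^k∸1]≤[2^k]^[2^k] (suc (suc j)) _ = begin
  4 ^ (K ∸ 1)  ≤⟨ ^-monoʳ-≤ 4 (m∸n≤m K 1) ⟩
  4 ^ K        ≤⟨ ^-monoˡ-≤ K 4≤K ⟩
  K ^ K        ∎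
  where
  open ≤-Reasoning
  K = 2 ^ (2 + j)
  4≤K : 4 ≤ K
  4≤K = ≤-trans (*-monoʳ-≤ 4 (m^n>0 2 j)) (≤-reflexive (sym (^-distribˡ-+-* 2 2 j)))

argmin : ∀ {c} (f : Fin (suc c) → ℕ) → Σ (Fin (suc c)) λ k → ∀ x → f k ≤ f x
argmin {zero}  f = zero , λ { zero → ≤-refl }
argmin {suc c} f with argmin (f ∘ suc)
... | k , min with f zero ≤? f (suc k)
... | yes f0≤ = zero  , λ { zero → ≤-refl ; (suc x) → ≤-trans f0≤ (min x) }
... | no  f0≰ = suc k , λ { zero → <⇒≤ (≰⇒> f0≰) ; (suc x) → min x }

sortingPermutation : ∀ {c} (f : Fin c → ℕ) →
  Σ (Permutation′ c) λ σ → ∀ {i j} → toℕ i ≤ toℕ j → f (σ ⟨$⟩ʳ i) ≤ f (σ ⟨$⟩ʳ j)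
sortingPermutation {zero}  f = Permutation.id , λ { {()} }
sortingPermutation {suc c} f with argmin f
... | k , min with sortingPermutation (f ∘ (transpose zero k ⟨$⟩ʳ_) ∘ suc)
... | σ , sorted = lift₀ σ ∘ₚ transpose zero k , λ
  { {zero}  {j}     _         → min ((lift₀ σ ∘ₚ transpose zero k) ⟨$⟩ʳ j)
  ; {suc i} {suc j} (s≤s i≤j) → sorted i≤j }

RefinesOn : ∀ {n} → SubsetP n → Partition n → Partition n → Set
RefinesOn B Q R = ∀ {x y} → B x → B y → Q x ≡ Q y → R x ≡ R y

-- Each colour of Q i on B is then the union of the colours of an earlier Q j that it meets.
refining-chain⇒distance≡1 : ∀ {n c} {B : SubsetP n} {Q : Fin (suc (suc c)) → Partition n} → ∃ B →
  (∀ {j i} → toℕ j < toℕ i → RefinesOn B (Q j) (Q i)) → DistanceIs B Q 1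
refining-chain⇒distance≡1 {B = B} {Q} (x₀ , x₀∈B) refines = distance≤1 , 1≤distance
  where
  distance≤1 : DistCond B Q 1
  distance≤1 i _ ℓ _ = [] , ≤-refl , [] , λ j j<i →
    (λ ℓ′ → ∃ λ y → B y × Q j y ≡ ℓ′ × Q i y ≡ ℓ) , λ x →
      (λ { (x∈B , inj₁ Qix≡ℓ) → x∈B , (x , x∈B , refl , Qix≡ℓ) ; (_ , inj₂ ()) }) ,
      (λ { (x∈B , (y , y∈B , Qjy≡Qjx , Qiy≡ℓ)) →
             x∈B , inj₁ (trans (refines j<i x∈B y∈B (sym Qjy≡Qjx)) Qiy≡ℓ) })

  1≤distance : ∀ Δ' → DistCond B Q Δ' → 1 ≤ Δ'
  1≤distance Δ' cond with cond (suc zero) ≤-refl (Q (suc zero) x₀) (x₀ , x₀∈B , refl)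
  ... | _ , 1+ys≤Δ' , _ = ≤-trans (s≤s z≤n) 1+ys≤Δ'

tagKey : Tag → ℕ
tagKey (inj₁ _) = 2
tagKey (inj₂ _) = 0

-- Partitions injective on the base set come first, those constant on it last,
-- and the untagged partition P 0 in between.
key : ∀ {c} → Vec Tag c → Fin (suc c) → ℕ
key v zero    = 1
key v (suc p) = tagKey (lookup v p)

module _ {n c} (P : Fin (suc c) → Partition n) (v : Vec Tag c) {x y : Fin n}
         (sound : ∀ p → TagSound (P (suc p)) (lookup v p) x y) where

  tagged-constant : ∀ q → 1 ≤ tagKey (lookup v q) → P (suc q) x ≡ P (suc q) y
  tagged-constant q 1≤key with lookup v q | sound q
  ... | inj₁ _ | Px≡Py = Px≡Py
  tagged-constant q () | inj₂ _ | _

  key-refines : ∀ a b → key v a ≤ key v b → P a x ≡ P a y → P b x ≡ P b y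
  key-refines zero    zero    _     Px≡Py = Px≡Py
  key-refines zero    (suc q) 1≤key _     = tagged-constant q 1≤key
  key-refines (suc p) b       key≤  Px≡Py with lookup v p | sound p
  ... | inj₂ _ | injective = cong (P b) (injective Px≡Py)
  key-refines (suc p) zero    (s≤s ()) _ | inj₁ _ | _
  key-refines (suc p) (suc q) 2≤key    _ | inj₁ _ | _ = tagged-constant q (≤-trans (s≤s z≤n) 2≤key)

module Iterated {n} (x₀ : Fin n) where

  1≤n : 1 ≤ n
  1≤n = ≤-trans (s≤s z≤n) (toℕ<n x₀)

  1≤#labels : ∀ {k} (lab : Fin n → Vec Tag k) → 1 ≤ #labels lab
  1≤#labels lab with labels lab | ∈-image _≟ᵗ_ lab x₀
  ... | _ ∷ _ | _ = s≤s z≤n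

  threshold : ∀ {k} → (Fin n → Vec Tag k) → ℕ
  threshold lab = proj₁ (least-s[n≤s*s*T] n (#labels lab) 1≤n (1≤#labels lab))

  threshold-spec : ∀ {k} (lab : Fin n → Vec Tag k) → let s = threshold lab in
    n ≤ s * s * #labels lab × (s ∸ 1) * (s ∸ 1) * #labels lab < n
  threshold-spec lab = proj₂ (least-s[n≤s*s*T] n (#labels lab) 1≤n (1≤#labels lab))

  refineAll : ∀ {k} → (Fin k → Partition n) → Fin n → Vec Tag k
  refineAll {zero}  _  _ = []
  refineAll {suc k} Qs   = Refine.refined (refineAll (Qs ∘ suc)) (Qs zero) (threshold (refineAll (Qs ∘ suc)))

  refineAll-sound : ∀ {k} (Qs : Fin k → Partition n) {v x y} → refineAll Qs x ≡ v → refineAll Qs y ≡ v →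
    ∀ p → TagSound (Qs p) (lookup v p) x y
  refineAll-sound Qs refl ly≡lx zero =
    Refine.refined-sound (refineAll (Qs ∘ suc)) (Qs zero) (threshold (refineAll (Qs ∘ suc))) (sym ly≡lx)
  refineAll-sound Qs refl ly≡lx (suc p) = refineAll-sound (Qs ∘ suc) refl (Vec.∷-injectiveʳ ly≡lx) p

  #labels-refineAll-step : ∀ {k} (Qs : Fin (suc k) → Partition n) →
    #labels (refineAll Qs) * #labels (refineAll Qs) < 4 * n * #labels (refineAll (Qs ∘ suc))
  #labels-refineAll-step Qs = refinement-square-bound {B = length largeLabels} (1≤#labels lab)
    (proj₁ (threshold-spec lab)) (proj₂ (threshold-spec lab)) length-largeLabels*s≤n #labels-refined≤
    where
    lab : Fin n → Vec Tag _
    lab = refineAll (Qs ∘ suc)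
    open Refine lab (Qs zero) (threshold lab)

  #labels-refineAll : ∀ {k} (Qs : Fin k → Partition n) → #labels (refineAll Qs) ^ (2 ^ k) ≤ (4 * n) ^ (2 ^ k ∸ 1)
  #labels-refineAll-< : ∀ {k} (Qs : Fin (suc k) → Partition n) →
    #labels (refineAll Qs) ^ (2 ^ suc k) < (4 * n) ^ (2 ^ suc k ∸ 1)

  #labels-refineAll {zero}  Qs = ≤-trans (≤-reflexive (*-identityʳ _))
    (Unique-⊆⇒length≤ {ys = [] ∷ []} (image-unique _≟ᵗ_ (refineAll Qs)) λ { {[]} _ → here refl })
  #labels-refineAll {suc k} Qs = <⇒≤ (#labels-refineAll-< Qs)

  #labels-refineAll-< {k} Qs =
    power-step (2 ^ k) (m^n>0 2 k) (#labels-refineAll (Qs ∘ suc)) (#labels-refineAll-step Qs)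

  #labels-refineAll-bound : ∀ {k} (Qs : Fin (suc k) → Partition n) → let K = 2 ^ suc k in
    #labels (refineAll Qs) ^ K < K ^ K * n ^ (K ∸ 1)
  #labels-refineAll-bound {k} Qs = begin-strict
    #labels (refineAll Qs) ^ K  <⟨ #labels-refineAll-< Qs ⟩
    (4 * n) ^ (K ∸ 1)           ≡⟨ ^-distribʳ-* 4 n (K ∸ 1) ⟩
    4 ^ (K ∸ 1) * n ^ (K ∸ 1)   ≤⟨ *-monoˡ-≤ (n ^ (K ∸ 1)) (4^[2^k∸1]≤[2^k]^[2^k] (suc k) (s≤s z≤n)) ⟩
    K ^ K * n ^ (K ∸ 1)         ∎
    where
    open ≤-Reasoning
    K = 2 ^ suc k

  labelled-set-distance≡1 : ∀ {c} (P : Fin (suc (suc c)) → Partition n) (v : Vec Tag (suc c)) {B : SubsetP n} →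
    ∃ B → (∀ {x} → B x → refineAll (P ∘ suc) x ≡ v) →
    Σ (Permutation′ (suc (suc c))) λ σ → DistanceIs B (λ j → P (σ ⟨$⟩ʳ j)) 1
  labelled-set-distance≡1 P v B≢∅ labelled with sortingPermutation (key v)
  ... | σ , sorted = σ , refining-chain⇒distance≡1 B≢∅ λ j<j′ x∈B y∈B →
    key-refines P v (refineAll-sound (P ∘ suc) (labelled x∈B) (labelled y∈B)) _ _ (sorted (<⇒≤ j<j′))

mainTheorem11 : (c n : ℕ) → 2 ≤ c → 1 ≤ n → (P : Fin c → Partition n) →
  Σ ℕ λ m → Σ (Fin n → Fin m) λ b →
    (∀ i → ∃ λ x → b x ≡ i) ×
    (m ^ (2 ^ (c ∸ 1)) < (2 ^ (c ∸ 1)) ^ (2 ^ (c ∸ 1)) * n ^ (2 ^ (c ∸ 1) ∸ 1)) ×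
    (∀ (i : Fin m) → Σ (Permutation′ c) λ σ →
       DistanceIs (λ x → b x ≡ i) (λ j → P (σ ⟨$⟩ʳ j)) 1)
mainTheorem11 (suc zero)    _         (s≤s ()) _ _
mainTheorem11 (suc (suc c)) n@(suc _) _ _ P =
  #labels lab , b , b-surjective , #labels-refineAll-bound (P ∘ suc) , ordering
  where
  open Iterated {n} zero

  lab : Fin n → Vec Tag (suc c)
  lab = refineAll (P ∘ suc)

  b : Fin n → Fin (#labels lab)
  b = imageIndex _≟ᵗ_ lab

  b-surjective : ∀ i → ∃ λ x → b x ≡ i
  b-surjective = imageIndex-surjective _≟ᵗ_ lab

  ordering : ∀ i → Σ (Permutation′ (suc (suc c))) λ σ → DistanceIs (λ x → b x ≡ i) (λ j → P (σ ⟨$⟩ʳ j)) 1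
  ordering i = labelled-set-distance≡1 P (List.lookup (labels lab) i) (b-surjective i) (imageIndex-fibre _≟ᵗ_ lab)
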